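{- For every $\varepsilon\in(0,1)$, the number of $\varepsilon$-major nodes of any tree $T$ is at most $\varepsilon^{ -2}$.
   Context: $T$ is a finite tree and $|T|$ its number of nodes. A node $u$ of $T$ is $\varepsilon$-major if the sum of the sizes of the two largest components of $T\setminus u$ is at most $(1-\varepsilon)|T|$.
   Formalization: The parameter ε ranges only over the rationals in (0,1), each given as a quotient of natural numbers. -}

module Defs where

open import Data.Nat using (ℕ; _+_; _*_; _∸_; _≤_; _<_)
open import Data.Fin using (Fin)
open import Data.List using (List; []; _∷_; length; _∷ʳ_)
open import Data.List.Relation.Unary.Unique.Propositional using (Unique)
open import Data.List.Relation.Unary.Linked using (Linked)
open import Data.List.Membership.Propositional using (_∈_)
open import Data.Product using (_×_; Σ)
open import Relation.Binary.PropositionalEquality using (_≡_; _≢_)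
open import Relation.Binary.Construct.Closure.ReflexiveTransitive using (Star)
open import Relation.Nullary using (¬_)
open import Function.Bundles using (_⇔_)
open import Level using (0ℓ)

record Graph (n : ℕ) : Set₁ where
  field
    Adj    : Fin n → Fin n → Set
    sym    : ∀ {x y} → Adj x y → Adj y x
    irrefl : ∀ {x} → ¬ Adj x x
open Graph public

Connected : ∀ {n} → Graph n → Set
Connected G = ∀ x y → Star (Adj G) x y

-- A cycle: distinct vertices x ∷ xs (at least 3 of them), consecutive ones
-- adjacent, and the last adjacent to x.
IsCycle : ∀ {n} → Graph n → Fin n → List (Fin n) → Set
IsCycle G x xs = (2 ≤ length xs) × Unique (x ∷ xs) × Linked (Adj G) ((x ∷ xs) ∷ʳ x)

Acyclic : ∀ {n} → Graph n → Set
Acyclic G = ∀ x xs → ¬ IsCycle G x xs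

record Tree (n : ℕ) : Set₁ where
  field
    graph     : Graph n
    connected : Connected graph
    acyclic   : Acyclic graph
open Tree public

AdjMinus : ∀ {n} → Tree n → Fin n → Fin n → Fin n → Set
AdjMinus T u x y = Adj (graph T) x y × x ≢ u × y ≢ u

-- x lies in the component of T \ u containing v (for v ≢ u).
SameComp : ∀ {n} → Tree n → Fin n → Fin n → Fin n → Set
SameComp T u v x = Star (AdjMinus T u) v x

CompSize : ∀ {n} → Tree n → Fin n → Fin n → ℕ → Set
CompSize {n} T u v k =
  Σ (List (Fin n)) λ l → Unique l × (∀ x → (x ∈ l) ⇔ SameComp T u v x) × (length l ≡ k)

-- u is ε-major, for ε = p / q, in an n-node tree:
-- the sum of the sizes of the two largest components of T \ u is ≤ (1 - ε) n,
-- i.e. (multiplying by q)  s * q ≤ (q - p) * n.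
-- Unfolded: every single component has size ≤ (1-ε)n (covers the case of
-- at most one component), and any two distinct components have total size ≤ (1-ε)n.
Major : ∀ {n} → (p q : ℕ) → Tree n → Fin n → Set
Major {n} p q T u =
  (∀ v k → v ≢ u → CompSize T u v k → k * q ≤ (q ∸ p) * n) ×
  (∀ v w k₁ k₂ → v ≢ u → w ≢ u → ¬ SameComp T u v w →
     CompSize T u v k₁ → CompSize T u w k₂ → (k₁ + k₂) * q ≤ (q ∸ p) * n)

-- Fix one major node r and call the far side of another node v the set of vertices that v
-- separates from r (v included).  Majority of v and of r puts the size of the far side of v
-- between εn and (1 - ε)n, and if v also separates w from r, then the far side of w lies in a
-- component of T ∖ v other than the one of r, so the two far-side sizes differ by at least εn.
-- The major nodes whose far side contains a given vertex x are totally ordered by separation,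
-- hence at most (1 - ε)/ε of them contain x.  Double counting then bounds the number of major
-- nodes other than r by (1 - ε)/ε², and adding r gives ε⁻².
module Submission where

open import Defs
open import Data.Nat using (ℕ; zero; suc; _+_; _*_; _∸_; _≤_; _<_; _≤?_; z≤n; NonZero)
open import Data.Nat.Properties hiding (_≟_)
open import Data.Fin using (Fin; zero; suc; _≟_)
open import Data.Fin.Properties using (nonZeroIndex)
open import Data.List using (List; []; _∷_; length; filter; map; allFin)
open import Data.List.Properties using (length-map; length-tabulate; map-cong)
open import Data.Nat.ListAction using (sum)
open import Data.List.Relation.Unary.All using (All; []; _∷_)
import Data.List.Relation.Unary.All as All
import Data.List.Relation.Unary.All.Properties as All
open import Data.List.Relation.Unary.AllPairs using (AllPairs; []; _∷_)
import Data.List.Relation.Unary.AllPairs.Properties as AllPairs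
open import Data.List.Relation.Unary.Linked using (Linked; [-]; _∷_)
import Data.List.Relation.Unary.Linked as Linked
open import Data.List.Relation.Unary.Linked.Properties using (AllPairs⇒Linked)
open import Data.List.Relation.Unary.Unique.Propositional using (Unique)
import Data.List.Relation.Unary.Unique.Propositional.Properties as Unique
open import Data.List.Relation.Binary.Sublist.Propositional using (⊆-refl)
import Data.List.Relation.Binary.Sublist.Propositional.Properties as Sublist
open import Data.List.Relation.Binary.Permutation.Propositional using (_↭_; ↭-sym; ↭⇒↭ₛ)
open import Data.List.Relation.Binary.Permutation.Propositional.Properties using (All-resp-↭; ↭-length)
import Data.List.Relation.Binary.Permutation.Setoid.Properties as Permutationₛ
open import Data.List.Sort ≤-decTotalOrder using (sort; sort-↭; sort-↗)
open import Data.List.Membership.Propositional.Properties using (∈-filter⁺; ∈-filter⁻; ∈-allFin)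
open import Data.Product using (_×_; _,_; proj₁; proj₂)
open import Data.Sum using (_⊎_; inj₁; inj₂)
open import Data.Empty using (⊥-elim)
open import Function using (_∘_)
open import Function.Bundles using (mk⇔)
open import Relation.Nullary using (¬_; Dec; yes; no; ¬?)
open import Relation.Nullary.Decidable using (decidable-stable; ¬¬-excluded-middle)
open import Relation.Nullary.Negation using (¬¬-map)
open import Relation.Unary using (Pred; Decidable)
open import Relation.Unary.Properties using (∁?)
open import Relation.Binary using (Rel)
open import Relation.Binary.Definitions using (DecidableEquality)
open import Relation.Binary.PropositionalEquality
  using (_≡_; _≢_; refl; cong; subst; ≢-sym; module ≡-Reasoning)
  renaming (sym to ≡-sym; trans to ≡-trans)
open import Relation.Binary.PropositionalEquality.Properties using (setoid)
open import Relation.Binary.Construct.Closure.ReflexiveTransitive using (Star; ε; _◅_; _◅◅_)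
import Relation.Binary.Construct.Closure.ReflexiveTransitive as Star
open import Data.Nat.Tactic.RingSolver using (solve-∀)
open import Level using (0ℓ)

private
  variable
    A B : Set

Avoiding : Rel A 0ℓ → A → Rel A 0ℓ
Avoiding R u x y = R x y × x ≢ u × y ≢ u

NotEntering : Rel A 0ℓ → A → Rel A 0ℓ
NotEntering R u x y = R x y × y ≢ u

module _ {R : Rel A 0ℓ} (_≟ₐ_ : DecidableEquality A) where

  -- The second alternative is the part of the walk after its last visit to u.
  lastVisit : ∀ u {a b} → Star R a b → (a ≢ u × Star (Avoiding R u) a b) ⊎ Star (NotEntering R u) u b
  lastVisit u {a} ε with a ≟ₐ u
  ... | yes refl = inj₂ ε
  ... | no a≢u   = inj₁ (a≢u , ε)
  lastVisit u {a} (e ◅ walk) with lastVisit u walk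
  ... | inj₂ tail = inj₂ tail
  ... | inj₁ (c≢u , tail) with a ≟ₐ u
  ...   | yes refl = inj₂ ((e , c≢u) ◅ Star.map (λ (e′ , _ , d≢u) → e′ , d≢u) tail)
  ...   | no a≢u   = inj₁ (a≢u , (e , a≢u , c≢u) ◅ tail)

NotEntering⇒Avoiding : ∀ {R : Rel A 0ℓ} {u a b} → a ≢ u → Star (NotEntering R u) a b → Star (Avoiding R u) a b
NotEntering⇒Avoiding a≢u ε = ε
NotEntering⇒Avoiding a≢u ((e , c≢u) ◅ walk) = (e , a≢u , c≢u) ◅ NotEntering⇒Avoiding c≢u walk

module _ {n} (T : Tree n) where

  -- Also holds for x = v.
  Separates : Fin n → Fin n → Fin n → Set
  Separates v r x = ¬ SameComp T v r x

  SameComp-sym : ∀ {u a b} → SameComp T u a b → SameComp T u b a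
  SameComp-sym = Star.reverse (λ (e , a≢u , b≢u) → Graph.sym (graph T) e , b≢u , a≢u)

  separates⇒SameComp : ∀ {v r x} → v ≢ r → Separates v r x → SameComp T r v x
  separates⇒SameComp {v} {r} {x} v≢r v∣x with lastVisit _≟_ r (connected T v x)
  ... | inj₁ (_ , walk) = walk
  ... | inj₂ walk with lastVisit _≟_ v walk
  ...   | inj₁ (_ , walk′) = ⊥-elim (v∣x (Star.map (λ ((e , _) , r≢v , c≢v) → e , r≢v , c≢v) walk′))
  ...   | inj₂ walk′       = NotEntering⇒Avoiding v≢r (Star.map proj₁ walk′)

  module _ (SameComp? : ∀ u a b → Dec (SameComp T u a b)) where

    Separates? : ∀ v r x → Dec (Separates v r x)
    Separates? v r x = ¬? (SameComp? v r x)

    private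
      SameComp-stable : ∀ {u a b} → ¬ Separates u a b → SameComp T u a b
      SameComp-stable = decidable-stable (SameComp? _ _ _)

    separates²⇒SameComp : ∀ {v w r y} → v ≢ w → Separates v r w → Separates w r y → SameComp T v w y
    separates²⇒SameComp {v} {w} {r} v≢w v∣w w∣y = SameComp-stable λ v∣y →
      w∣y (SameComp-sym v∼r ◅◅ separates⇒SameComp v≢w v∣y)
      where
      v∼r : SameComp T w v r
      v∼r = SameComp-stable λ w∣r → v∣w (SameComp-sym (separates⇒SameComp (≢-sym v≢w) w∣r))

    separators-comparable : ∀ {v w r x} → v ≢ w → Separates v r x → Separates w r x →
                            Separates v r w ⊎ Separates w r v
    separators-comparable {v} {w} {r} {x} v≢w v∣x w∣x with SameComp? v r w | SameComp? w r v
    ... | no v∣w | _      = inj₁ v∣w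
    ... | yes _  | no w∣v = inj₂ w∣v
    ... | yes r∼w | yes r∼v = ⊥-elim (w∣x (r∼v ◅◅ v∼x))
      where
      v∼x : SameComp T w v x
      v∼x = SameComp-stable λ w∣x′ → v∣x (r∼w ◅◅ separates⇒SameComp (≢-sym v≢w) w∣x′)

module _ {P : Pred A 0ℓ} (P? : Decidable P) where

  length-filter+length-filter-∁ : ∀ xs → length (filter P? xs) + length (filter (∁? P?) xs) ≡ length xs
  length-filter+length-filter-∁ [] = refl
  length-filter+length-filter-∁ (x ∷ xs) with P? x
  ... | yes _ = cong suc (length-filter+length-filter-∁ xs)
  ... | no _  = ≡-trans (+-suc _ _) (cong suc (length-filter+length-filter-∁ xs))

  length-filter-mono : ∀ {Q : Pred A 0ℓ} (Q? : Decidable Q) → (∀ {x} → P x → Q x) → ∀ xs →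
                       length (filter P? xs) ≤ length (filter Q? xs)
  length-filter-mono Q? P⇒Q xs =
    Sublist.length-mono-≤ (Sublist.filter⁺ P? Q? (λ { refl → P⇒Q }) (⊆-refl {x = xs}))

length-allFin : ∀ n → length (allFin n) ≡ n
length-allFin n = length-tabulate {n = n} (λ x → x)

indicator : ∀ {P : Set} → Dec P → ℕ
indicator (yes _) = 1
indicator (no _)  = 0

length-filter≡sum-indicator : ∀ {P : Pred A 0ℓ} (P? : Decidable P) xs →
                              length (filter P? xs) ≡ sum (map (indicator ∘ P?) xs)
length-filter≡sum-indicator P? [] = refl
length-filter≡sum-indicator P? (x ∷ xs) with P? x
... | yes _ = cong suc (length-filter≡sum-indicator P? xs)
... | no _  = length-filter≡sum-indicator P? xs

sum-map-+ : ∀ (f g : A → ℕ) xs → sum (map (λ x → f x + g x) xs) ≡ sum (map f xs) + sum (map g xs)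
sum-map-+ f g [] = refl
sum-map-+ f g (x ∷ xs) rewrite sum-map-+ f g xs = +-+-comm (f x) (g x) _ _
  where
  +-+-comm : ∀ a b c d → (a + b) + (c + d) ≡ (a + c) + (b + d)
  +-+-comm = solve-∀

sum-map-zero : ∀ (xs : List A) → sum (map (λ _ → 0) xs) ≡ 0
sum-map-zero [] = refl
sum-map-zero (_ ∷ xs) = sum-map-zero xs

sum-map-comm : ∀ (g : A → B → ℕ) as bs →
               sum (map (λ a → sum (map (g a) bs)) as) ≡ sum (map (λ b → sum (map (λ a → g a b) as)) bs)
sum-map-comm g [] bs = ≡-sym (sum-map-zero bs)
sum-map-comm g (a ∷ as) bs = begin
  sum (map (g a) bs) + sum (map (λ a′ → sum (map (g a′) bs)) as)     ≡⟨ cong (_ +_) (sum-map-comm g as bs) ⟩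
  sum (map (g a) bs) + sum (map (λ b → sum (map (λ a′ → g a′ b) as)) bs) ≡⟨ ≡-sym (sum-map-+ (g a) _ bs) ⟩
  sum (map (λ b → g a b + sum (map (λ a′ → g a′ b) as)) bs)            ∎
  where open ≡-Reasoning

double-counting : ∀ {R : A → B → Set} (R? : ∀ a b → Dec (R a b)) as bs →
                  sum (map (λ a → length (filter (R? a) bs)) as) ≡
                  sum (map (λ b → length (filter (λ a → R? a b) as)) bs)
double-counting R? as bs = begin
  sum (map (λ a → length (filter (R? a) bs)) as)
    ≡⟨ cong sum (map-cong (λ a → length-filter≡sum-indicator (R? a) bs) as) ⟩
  sum (map (λ a → sum (map (λ b → indicator (R? a b)) bs)) as)
    ≡⟨ sum-map-comm (λ a b → indicator (R? a b)) as bs ⟩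
  sum (map (λ b → sum (map (λ a → indicator (R? a b)) as)) bs)
    ≡⟨ cong sum (map-cong (λ b → ≡-sym (length-filter≡sum-indicator (λ a → R? a b) as)) bs) ⟩
  sum (map (λ b → length (filter (λ a → R? a b) as)) bs)
    ∎
  where open ≡-Reasoning

length*≤*sum : ∀ (f : A → ℕ) k {c} xs → All (λ x → c ≤ k * f x) xs → length xs * c ≤ k * sum (map f xs)
length*≤*sum f k [] [] = z≤n
length*≤*sum f k {c} (x ∷ xs) (c≤kfx ∷ bounds) = begin
  c + length xs * c            ≤⟨ +-mono-≤ c≤kfx (length*≤*sum f k xs bounds) ⟩
  k * f x + k * sum (map f xs) ≡⟨ *-distribˡ-+ k (f x) _ ⟨
  k * (f x + sum (map f xs))   ∎
  where open ≤-Reasoning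

sum*≤length* : ∀ (f : A → ℕ) k {c} xs → (∀ x → f x * k ≤ c) → sum (map f xs) * k ≤ length xs * c
sum*≤length* f k [] bound = z≤n
sum*≤length* f k {c} (x ∷ xs) bound = begin
  (f x + sum (map f xs)) * k   ≡⟨ *-distribʳ-+ k (f x) _ ⟩
  f x * k + sum (map f xs) * k ≤⟨ +-mono-≤ (bound x) (sum*≤length* f k xs bound) ⟩
  c + length xs * c            ∎
  where open ≤-Reasoning

AllPairs-zipWithAll : ∀ {P : Pred A 0ℓ} {R S : Rel A 0ℓ} → (∀ {a b} → P a → P b → R a b → S a b) →
                      ∀ {xs} → All P xs → AllPairs R xs → AllPairs S xs
AllPairs-zipWithAll f [] [] = []
AllPairs-zipWithAll f (pa ∷ ps) (rs ∷ rss) =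
  All.zipWith (λ (pb , r) → f pa pb r) (ps , rs) ∷ AllPairs-zipWithAll f ps rss

Separated : ℕ → ℕ → ℕ → Set
Separated d a b = a + d ≤ b ⊎ b + d ≤ a

Separated-sym : ∀ {d a b} → Separated d a b → Separated d b a
Separated-sym (inj₁ h) = inj₂ h
Separated-sym (inj₂ h) = inj₁ h

≤∧Separated⇒+≤ : ∀ {d a b} → a ≤ b → Separated d a b → a + d ≤ b
≤∧Separated⇒+≤ a≤b (inj₁ a+d≤b) = a+d≤b
≤∧Separated⇒+≤ {d} {a} {b} a≤b (inj₂ b+d≤a) = begin
  a + d ≤⟨ +-monoʳ-≤ a d≤0 ⟩
  a + 0 ≡⟨ +-identityʳ a ⟩
  a     ≤⟨ a≤b ⟩
  b     ∎
  where
  open ≤-Reasoning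
  d≤0 : d ≤ 0
  d≤0 = +-cancelˡ-≤ b d 0 (subst (b + d ≤_) (≡-sym (+-identityʳ b)) (≤-trans b+d≤a a≤b))

module _ {d U : ℕ} where
  open ≤-Reasoning

  increasing-length : ∀ {x xs} → Linked (λ a b → a + d ≤ b) (x ∷ xs) → All (_≤ U) (x ∷ xs) →
                      x + length xs * d ≤ U
  increasing-length {x} [-] (x≤U ∷ []) = subst (_≤ U) (≡-sym (+-identityʳ x)) x≤U
  increasing-length {x} {y ∷ xs} (x+d≤y ∷ increasing) (_ ∷ bounded) = begin
    x + (d + length xs * d) ≡⟨ +-assoc x d _ ⟨
    x + d + length xs * d   ≤⟨ +-monoˡ-≤ (length xs * d) x+d≤y ⟩
    y + length xs * d       ≤⟨ increasing-length increasing bounded ⟩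
    U                       ∎

  sorted-separated-length : ∀ xs → Linked _≤_ xs → AllPairs (Separated d) xs →
                            All (d ≤_) xs → All (_≤ U) xs → length xs * d ≤ U
  sorted-separated-length [] _ _ _ _ = z≤n
  sorted-separated-length (x ∷ xs) sorted separated (d≤x ∷ _) bounded = begin
    d + length xs * d ≤⟨ +-monoˡ-≤ (length xs * d) d≤x ⟩
    x + length xs * d ≤⟨ increasing-length increasing bounded ⟩
    U                 ∎
    where
    increasing : Linked (λ a b → a + d ≤ b) (x ∷ xs)
    increasing = Linked.zipWith (λ (a≤b , s) → ≤∧Separated⇒+≤ a≤b s) (sorted , AllPairs⇒Linked separated)

  -- Sorted, the values increase by at least d at each step.
  separated-length : ∀ xs → AllPairs (Separated d) xs → All (d ≤_) xs → All (_≤ U) xs → length xs * d ≤ U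
  separated-length xs separated lower upper =
    subst (λ m → m * d ≤ U) (↭-length (sort-↭ xs))
      (sorted-separated-length (sort xs) (sort-↗ xs)
        (Permutationₛ.AllPairs-resp-↭ (setoid ℕ) Separated-sym ((λ { refl s → s }) , (λ { refl s → s }))
          (↭⇒↭ₛ xs↭sorted) separated)
        (All-resp-↭ xs↭sorted lower) (All-resp-↭ xs↭sorted upper))
    where
    xs↭sorted : xs ↭ sort xs
    xs↭sorted = ↭-sym (sort-↭ xs)

¬¬-Π-Fin : ∀ {m} {Q : Fin m → Set} → (∀ i → ¬ ¬ Q i) → ¬ ¬ (∀ i → Q i)
¬¬-Π-Fin {zero}  _ k = k (λ ())
¬¬-Π-Fin {suc m} h k = h zero λ q₀ → ¬¬-Π-Fin (h ∘ suc) λ qₛ → k λ { zero → q₀ ; (suc i) → qₛ i }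

¬¬-SameComp-decidable : ∀ {n} (T : Tree n) → ¬ ¬ (∀ u a b → Dec (SameComp T u a b))
¬¬-SameComp-decidable T = ¬¬-Π-Fin λ _ → ¬¬-Π-Fin λ _ → ¬¬-Π-Fin λ _ → ¬¬-excluded-middle

-- Sizes are compared after multiplication by q, so that εn and (1 - ε)n become p * n and (q ∸ p) * n.
module MajorNodes {p q n} (p≤q : p ≤ q) (T : Tree n) (SameComp? : ∀ u a b → Dec (SameComp T u a b))
                  (r : Fin n) (r-major : Major p q T r) where

  private instance
    n≢0 : NonZero n
    n≢0 = nonZeroIndex r

  size : Fin n → Fin n → ℕ
  size u a = length (filter (SameComp? u a) (allFin n))

  size-CompSize : ∀ u a → CompSize T u a (size u a)
  size-CompSize u a =
    filter (SameComp? u a) (allFin n) ,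
    Unique.filter⁺ (SameComp? u a) (Unique.allFin⁺ n) ,
    (λ x → mk⇔ (proj₂ ∘ ∈-filter⁻ (SameComp? u a) {xs = allFin n})
               (∈-filter⁺ (SameComp? u a) {xs = allFin n} (∈-allFin x))) ,
    refl

  far : Fin n → ℕ
  far v = length (filter (Separates? T SameComp? v r) (allFin n))

  q*size+q*far : ∀ v → q * size v r + q * far v ≡ (q ∸ p) * n + p * n
  q*size+q*far v = begin
    q * size v r + q * far v   ≡⟨ *-distribˡ-+ q (size v r) (far v) ⟨
    q * (size v r + far v)     ≡⟨ cong (q *_) (length-filter+length-filter-∁ (SameComp? v r) (allFin n)) ⟩
    q * length (allFin n)      ≡⟨ cong (q *_) (length-allFin n) ⟩
    q * n                      ≡⟨ cong (_* n) (m∸n+n≡m p≤q) ⟨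
    (q ∸ p + p) * n            ≡⟨ *-distribʳ-+ n (q ∸ p) p ⟩
    (q ∸ p) * n + p * n        ∎
    where open ≡-Reasoning

  far-lower : ∀ {v} → Major p q T v → v ≢ r → p * n ≤ q * far v
  far-lower {v} v-major v≢r = +-cancelˡ-≤ (q * size v r) _ _ (begin
    q * size v r + p * n       ≤⟨ +-monoˡ-≤ (p * n) (subst (_≤ (q ∸ p) * n) (*-comm (size v r) q) r-side) ⟩
    (q ∸ p) * n + p * n        ≡⟨ q*size+q*far v ⟨
    q * size v r + q * far v   ∎)
    where
    open ≤-Reasoning
    r-side : size v r * q ≤ (q ∸ p) * n
    r-side = proj₁ v-major r (size v r) (≢-sym v≢r) (size-CompSize v r)

  far-upper : ∀ {v} → v ≢ r → q * far v ≤ (q ∸ p) * n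
  far-upper {v} v≢r = begin
    q * far v    ≤⟨ *-monoʳ-≤ q (length-filter-mono _ (SameComp? r v) (separates⇒SameComp T v≢r) (allFin n)) ⟩
    q * size r v ≡⟨ *-comm q (size r v) ⟩
    size r v * q ≤⟨ proj₁ r-major v (size r v) v≢r (size-CompSize r v) ⟩
    (q ∸ p) * n  ∎
    where open ≤-Reasoning

  far-gap : ∀ {v w} → Major p q T v → v ≢ r → v ≢ w → Separates T v r w → q * far w + p * n ≤ q * far v
  far-gap {v} {w} v-major v≢r v≢w v∣w = +-cancelˡ-≤ (q * size v r) _ _ (begin
    q * size v r + (q * far w + p * n)    ≤⟨ +-monoʳ-≤ (q * size v r) (+-monoˡ-≤ (p * n) (*-monoʳ-≤ q w-side⊆)) ⟩
    q * size v r + (q * size v w + p * n) ≡⟨ regroup q (size v r) (size v w) (p * n) ⟩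
    (size v r + size v w) * q + p * n     ≤⟨ +-monoˡ-≤ (p * n) two-sides ⟩
    (q ∸ p) * n + p * n                   ≡⟨ q*size+q*far v ⟨
    q * size v r + q * far v              ∎)
    where
    open ≤-Reasoning
    regroup : ∀ k a b c → k * a + (k * b + c) ≡ (a + b) * k + c
    regroup = solve-∀
    w-side⊆ : far w ≤ size v w
    w-side⊆ = length-filter-mono _ (SameComp? v w) (separates²⇒SameComp T SameComp? v≢w v∣w) (allFin n)
    two-sides : (size v r + size v w) * q ≤ (q ∸ p) * n
    two-sides = proj₂ v-major r w (size v r) (size v w) (≢-sym v≢r) (≢-sym v≢w) v∣w
                  (size-CompSize v r) (size-CompSize v w)

  OtherMajor : Fin n → Set
  OtherMajor v = Major p q T v × v ≢ r

  far-separated : ∀ x {v w} → OtherMajor v × Separates T v r x → OtherMajor w × Separates T w r x →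
                  v ≢ w → Separated (p * n) (q * far v) (q * far w)
  far-separated x ((v-major , v≢r) , v∣x) ((w-major , w≢r) , w∣x) v≢w
    with separators-comparable T SameComp? v≢w v∣x w∣x
  ... | inj₁ v∣w = inj₂ (far-gap v-major v≢r v≢w v∣w)
  ... | inj₂ w∣v = inj₁ (far-gap w-major w≢r (≢-sym v≢w) w∣v)

  module _ (M : List (Fin n)) (others : All OtherMajor M) (distinct : AllPairs _≢_ M) where

    multiplicity : Fin n → ℕ
    multiplicity x = length (filter (λ v → Separates? T SameComp? v r x) M)

    multiplicity-bound : ∀ x → multiplicity x * p ≤ q ∸ p
    multiplicity-bound x = *-cancelʳ-≤ _ _ n (begin
      multiplicity x * p * n          ≡⟨ *-assoc (multiplicity x) p n ⟩
      multiplicity x * (p * n)        ≡⟨ cong (_* (p * n)) (length-map (λ v → q * far v) xs) ⟨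
      length (map (λ v → q * far v) xs) * (p * n)
        ≤⟨ separated-length _
             (AllPairs.map⁺ (AllPairs-zipWithAll (far-separated x) in-xs (AllPairs.filter⁺ _ distinct)))
             (All.map⁺ (All.map (λ ((v-major , v≢r) , _) → far-lower v-major v≢r) in-xs))
             (All.map⁺ (All.map (λ ((_ , v≢r) , _) → far-upper v≢r) in-xs)) ⟩
      (q ∸ p) * n                     ∎)
      where
      open ≤-Reasoning
      xs : List (Fin n)
      xs = filter (λ v → Separates? T SameComp? v r x) M
      in-xs : All (λ v → OtherMajor v × Separates T v r x) xs
      in-xs = All.zip (All.filter⁺ _ others , All.all-filter _ M)

    others-bound : length M * p * p ≤ q * (q ∸ p)
    others-bound = *-cancelʳ-≤ _ _ n (begin
      length M * p * p * n            ≡⟨ regroup (length M) p n ⟩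
      length M * (p * n) * p
        ≤⟨ *-monoˡ-≤ p (length*≤*sum far q M (All.map (λ (v-major , v≢r) → far-lower v-major v≢r) others)) ⟩
      q * sum (map far M) * p         ≡⟨ *-assoc q _ p ⟩
      q * (sum (map far M) * p)
        ≡⟨ cong (λ s → q * (s * p)) (double-counting (λ v x → Separates? T SameComp? v r x) M (allFin n)) ⟩
      q * (sum (map multiplicity (allFin n)) * p)
        ≤⟨ *-monoʳ-≤ q (sum*≤length* multiplicity p (allFin n) multiplicity-bound) ⟩
      q * (length (allFin n) * (q ∸ p)) ≡⟨ cong (λ m → q * (m * (q ∸ p))) (length-allFin n) ⟩
      q * (n * (q ∸ p))               ≡⟨ regroup′ q n (q ∸ p) ⟩
      q * (q ∸ p) * n                 ∎)
      where
      open ≤-Reasoning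
      regroup : ∀ a b c → a * b * b * c ≡ a * (b * c) * b
      regroup = solve-∀
      regroup′ : ∀ a b c → a * (b * c) ≡ a * c * b
      regroup′ = solve-∀

    majors-bound : suc (length M) * (p * p) ≤ q * q
    majors-bound = begin
      p * p + length M * (p * p)      ≡⟨ cong (p * p +_) (*-assoc (length M) p p) ⟨
      p * p + length M * p * p        ≤⟨ +-mono-≤ (*-monoˡ-≤ p p≤q) others-bound ⟩
      q * p + q * (q ∸ p)             ≡⟨ *-distribˡ-+ q p (q ∸ p) ⟨
      q * (p + (q ∸ p))               ≡⟨ cong (q *_) (m+[n∸m]≡n p≤q) ⟩
      q * q                           ∎
      where open ≤-Reasoning

lemma4 : (p q : ℕ) → 0 < p → p < q → (n : ℕ) (T : Tree n) (l : List (Fin n)) → Unique l → All (Major p q T) l → length l * (p * p) ≤ q * q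
lemma4 p q _ _ n T [] _ _ = z≤n
lemma4 p q _ p<q n T (r ∷ M) (r∉M ∷ distinct) (r-major ∷ majors) =
  decidable-stable (_ ≤? _) (¬¬-map bound (¬¬-SameComp-decidable T))
  where
  bound : (∀ u a b → Dec (SameComp T u a b)) → suc (length M) * (p * p) ≤ q * q
  bound SameComp? = MajorNodes.majors-bound (<⇒≤ p<q) T SameComp? r r-major M
    (All.zipWith (λ (v-major , r≢v) → v-major , ≢-sym r≢v) (majors , r∉M)) distinct
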